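{- Let $p$ be an odd prime. For every integer $n\ge 0$ let $T_n$ denote the $n$th central trinomial coefficient. Then $$\sum_{0 \leq n \leq p-1} T_n x^n \equiv (1 - 2x - 3x^2)^{\frac{p-1}{2}} \pmod p,$$ i.e. the two polynomials with integer coefficients have coefficientwise congruent coefficients modulo $p$ (equality in $(\mathbb{Z}/p\mathbb{Z})[x]$).
   Context: For an integer $n \geq 0$, the $n$th central trinomial coefficient $T_n$ is the coefficient of $x^n$ in the expansion of $(1+x+x^2)^n$ (equivalently, the largest coefficient of this polynomial). -}

module Defs where

open import Data.Nat using (ℕ; zero; suc; _<ᵇ_)
open import Data.Integer using (ℤ; +_; _+_; _*_)
open import Data.List using (List; []; _∷_)
open import Data.Bool using (if_then_else_)

-- Polynomials with integer coefficients, as coefficient lists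
-- (lowest degree first): a₀ ∷ a₁ ∷ … represents a₀ + a₁ x + …
Poly : Set
Poly = List ℤ

_⊕_ : Poly → Poly → Poly
[] ⊕ q = q
(a ∷ p) ⊕ [] = a ∷ p
(a ∷ p) ⊕ (b ∷ q) = (a + b) ∷ (p ⊕ q)

scale : ℤ → Poly → Poly
scale c [] = []
scale c (a ∷ p) = (c * a) ∷ scale c p

_⊗_ : Poly → Poly → Poly
[] ⊗ q = []
(a ∷ p) ⊗ q = scale a q ⊕ (+ 0 ∷ (p ⊗ q))

_^ᴾ_ : Poly → ℕ → Poly
p ^ᴾ zero = + 1 ∷ []
p ^ᴾ suc n = p ⊗ (p ^ᴾ n)

coeff : Poly → ℕ → ℤ
coeff [] k = + 0
coeff (a ∷ p) zero = a
coeff (a ∷ p) (suc k) = coeff p k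

trinom : Poly
trinom = + 1 ∷ + 1 ∷ + 1 ∷ []

T : ℕ → ℤ
T n = coeff (trinom ^ᴾ n) n

-- coefficient of x^k in  Σ_{0 ≤ n ≤ p-1} T_n x^n  (i.e. T k if k < p, else 0)
truncT : ℕ → ℕ → ℤ
truncT p k = if k <ᵇ p then T k else + 0

quadr : Poly
quadr = + 1 ∷ Data.Integer.-_ (+ 2) ∷ Data.Integer.-_ (+ 3) ∷ []

{-# OPTIONS --safe #-}
-- For P = a + b x + c x², the coefficients of Pⁿ satisfy the Euler relation P·(Pⁿ)′ = n·P′·Pⁿ.
-- For P = 1 + x + x² it yields the classical recurrence
--   (k + 2) T (k + 2) = (2k + 3) T (k + 1) + 3 (k + 1) T k,
-- and for P = 1 - 2x - 3x² and n = m = (p - 1) / 2, where 2m ≡ -1 (mod p), the same recurrence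
-- modulo p. Both sequences start with 1, 1 (mod p), and k + 2 is invertible modulo p while k + 2 < p,
-- so they agree below p. From p on, both the truncated series and (1 - 2x - 3x²)^m, of degree p - 1,
-- have zero coefficients.
module Submission where

open import Defs

open import Data.Nat as ℕ using (ℕ; zero; suc; _<_; _≤_; _/_; _<ᵇ_; s≤s)
open import Data.Nat.Primality using (Prime; euclidsLemma)
open import Data.Nat.Properties using (<⇒≤; <⇒≱; ≮⇒≥; m<n⇒m<1+n; <ᵇ-reflects-<)
open import Data.Nat.DivMod using (_%_; m≡m%n+[m/n]*n; m%n<n)
open import Data.Nat.Divisibility using (∣⇒≤; m%n≡0⇒n∣m) renaming (_∣_ to _∣ℕ_)
open import Data.Integer using (ℤ; +_; -[1+_]; _+_; _*_; -_; _-_; _^_; ∣_∣)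
open import Data.Integer.Properties
  using (abs-*; pos-*; +-identityˡ; +-identityʳ; *-zeroʳ; *-cancelˡ-≡; ^-zeroˡ; i-j≡0⇒i≡j)
open import Data.Integer.Divisibility using (_∣_)
open import Data.Integer.Divisibility.Signed as Signed
  using (divides; ∣m∣n⇒∣m+n; ∣m⇒∣-m; ∣n⇒∣m*n; ∣ᵤ⇒∣; ∣⇒∣ᵤ)
open import Data.Integer.Tactic.RingSolver using (solve-∀)
open import Data.Bool using (true; false)
open import Data.List using ([]; _∷_)
open import Data.Product using (_×_; _,_; proj₂)
open import Data.Sum using (inj₁; inj₂)
open import Relation.Binary.Bundles using (Setoid)
open import Relation.Binary.PropositionalEquality
import Relation.Binary.Reasoning.Setoid as ≈-Reasoning
open import Relation.Nullary using (¬_; contradiction)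
open import Relation.Nullary.Reflects using (ofʸ; ofⁿ)

≡-by-multiple : ∀ {x y} u {l r} → x - y ≡ u * (l - r) → l ≡ r → x ≡ y
≡-by-multiple {x} {y} u {l} x-y≡u[l-l] refl = i-j≡0⇒i≡j x y (trans x-y≡u[l-l] (u*[l-l]≡0 u l))
  where
  u*[l-l]≡0 : ∀ u l → u * (l - l) ≡ + 0
  u*[l-l]≡0 = solve-∀

≡-by-combination : ∀ {x y} u v w {l₀ r₀ l₁ r₁ l₂ r₂} →
                   x - y ≡ u * (l₀ - r₀) + v * (l₁ - r₁) + w * (l₂ - r₂) →
                   l₀ ≡ r₀ → l₁ ≡ r₁ → l₂ ≡ r₂ → x ≡ y
≡-by-combination {x} {y} u v w {l₀} {_} {l₁} {_} {l₂} x-y≡combination refl refl refl =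
  i-j≡0⇒i≡j x y (trans x-y≡combination (combination≡0 u v w l₀ l₁ l₂))
  where
  combination≡0 : ∀ u v w l₀ l₁ l₂ → u * (l₀ - l₀) + v * (l₁ - l₁) + w * (l₂ - l₂) ≡ + 0
  combination≡0 = solve-∀

infix 4 _≡_mod_

record _≡_mod_ (x y : ℤ) (n : ℕ) : Set where
  constructor congruent
  field divides-difference : + n Signed.∣ x - y

module _ {n : ℕ} where

  ≡⇒≡-mod : ∀ {x y} → x ≡ y → x ≡ y mod n
  ≡⇒≡-mod {x} refl = congruent (divides (+ 0) (x-x≡0 x))
    where
    x-x≡0 : ∀ x → x - x ≡ + 0
    x-x≡0 = solve-∀

  ≡-mod-sym : ∀ {x y} → x ≡ y mod n → y ≡ x mod n
  ≡-mod-sym {x} {y} (congruent n∣x-y) =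
    congruent (subst (+ n Signed.∣_) (-[x-y]≡y-x x y) (∣m⇒∣-m n∣x-y))
    where
    -[x-y]≡y-x : ∀ x y → - (x - y) ≡ y - x
    -[x-y]≡y-x = solve-∀

  ≡-mod-trans : ∀ {x y z} → x ≡ y mod n → y ≡ z mod n → x ≡ z mod n
  ≡-mod-trans {x} {y} {z} (congruent n∣x-y) (congruent n∣y-z) =
    congruent (subst (+ n Signed.∣_) (telescope x y z) (∣m∣n⇒∣m+n n∣x-y n∣y-z))
    where
    telescope : ∀ x y z → (x - y) + (y - z) ≡ x - z
    telescope = solve-∀

  +-cong-mod : ∀ {x y u v} → x ≡ y mod n → u ≡ v mod n → x + u ≡ y + v mod n
  +-cong-mod {x} {y} {u} {v} (congruent n∣x-y) (congruent n∣u-v) =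
    congruent (subst (+ n Signed.∣_) (regroup x y u v) (∣m∣n⇒∣m+n n∣x-y n∣u-v))
    where
    regroup : ∀ x y u v → (x - y) + (u - v) ≡ (x + u) - (y + v)
    regroup = solve-∀

  *-congˡ-mod : ∀ k {x y} → x ≡ y mod n → k * x ≡ k * y mod n
  *-congˡ-mod k {x} {y} (congruent n∣x-y) =
    congruent (subst (+ n Signed.∣_) (distrib k x y) (∣n⇒∣m*n k n∣x-y))
    where
    distrib : ∀ k x y → k * (x - y) ≡ k * x - k * y
    distrib = solve-∀

  ≡-mod-setoid : Setoid _ _
  ≡-mod-setoid = record
    { Carrier = ℤ
    ; _≈_ = λ x y → x ≡ y mod n
    ; isEquivalence = record
      { refl = ≡⇒≡-mod refl ; sym = ≡-mod-sym ; trans = ≡-mod-trans }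
    }

*-cancelˡ-mod : ∀ {p} k {x y} → Prime p → ¬ p ∣ℕ k →
                + k * x ≡ + k * y mod p → x ≡ y mod p
*-cancelˡ-mod {p} k {x} {y} p-prime p∤k (congruent p∣kx-ky)
  with euclidsLemma k ∣ x - y ∣ p-prime p∣k∣x-y∣
  where
  p∣k∣x-y∣ : p ∣ℕ k ℕ.* ∣ x - y ∣
  p∣k∣x-y∣ = subst (p ∣ℕ_) (abs-* (+ k) (x - y))
               (∣⇒∣ᵤ (subst (+ p Signed.∣_) (factor (+ k) x y) p∣kx-ky))
    where
    factor : ∀ k x y → k * x - k * y ≡ k * (x - y)
    factor = solve-∀
... | inj₁ p∣k = contradiction p∣k p∤k
... | inj₂ p∣x-y = congruent (∣ᵤ⇒∣ p∣x-y)

SolvesRecurrenceMod : ℕ → (α β u : ℕ → ℤ) → Set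
SolvesRecurrenceMod p α β u =
  ∀ k → + (2 ℕ.+ k) * u (2 ℕ.+ k) ≡ α k * u (1 ℕ.+ k) + β k * u k mod p

module _ {p : ℕ} (p-prime : Prime p) (α β : ℕ → ℤ) {u v : ℕ → ℤ}
         (u-solves : SolvesRecurrenceMod p α β u) (v-solves : SolvesRecurrenceMod p α β v)
         (u₀≡v₀ : u 0 ≡ v 0 mod p) (u₁≡v₁ : u 1 ≡ v 1 mod p) where

  private
    consecutive-≡-mod : ∀ k → suc k < p → u k ≡ v k mod p × u (suc k) ≡ v (suc k) mod p
    consecutive-≡-mod zero    _     = u₀≡v₀ , u₁≡v₁
    consecutive-≡-mod (suc k) 2+k<p with consecutive-≡-mod k (<⇒≤ 2+k<p)
    ... | uₖ≡vₖ , uₖ₊₁≡vₖ₊₁ = uₖ₊₁≡vₖ₊₁ , *-cancelˡ-mod (2 ℕ.+ k) p-prime p∤2+k (begin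
        + (2 ℕ.+ k) * u (2 ℕ.+ k)      ≈⟨ u-solves k ⟩
        α k * u (1 ℕ.+ k) + β k * u k  ≈⟨ +-cong-mod (*-congˡ-mod (α k) uₖ₊₁≡vₖ₊₁) (*-congˡ-mod (β k) uₖ≡vₖ) ⟩
        α k * v (1 ℕ.+ k) + β k * v k  ≈⟨ ≡-mod-sym (v-solves k) ⟩
        + (2 ℕ.+ k) * v (2 ℕ.+ k)      ∎)
      where
      open ≈-Reasoning ≡-mod-setoid
      p∤2+k : ¬ p ∣ℕ 2 ℕ.+ k
      p∤2+k p∣2+k = <⇒≱ 2+k<p (∣⇒≤ p∣2+k)

  recurrence-solutions-≡-mod : ∀ {k} → k < p → u k ≡ v k mod p
  recurrence-solutions-≡-mod {zero}  _   = u₀≡v₀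
  recurrence-solutions-≡-mod {suc k} k<p = proj₂ (consecutive-≡-mod k k<p)

coeff-⊕ : ∀ p q k → coeff (p ⊕ q) k ≡ coeff p k + coeff q k
coeff-⊕ []      q       k       = sym (+-identityˡ _)
coeff-⊕ (a ∷ p) []      k       = sym (+-identityʳ _)
coeff-⊕ (a ∷ p) (b ∷ q) zero    = refl
coeff-⊕ (a ∷ p) (b ∷ q) (suc k) = coeff-⊕ p q k

coeff-scale : ∀ c p k → coeff (scale c p) k ≡ c * coeff p k
coeff-scale c []      k       = sym (*-zeroʳ c)
coeff-scale c (a ∷ p) zero    = refl
coeff-scale c (a ∷ p) (suc k) = coeff-scale c p k

-- Integer indices let the shifted coefficients at j - 1 and j - 2 be written uniformly;
-- negative indices carry the coefficient 0.
coeffℤ : Poly → ℤ → ℤ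
coeffℤ p (+ k)     = coeff p k
coeffℤ p -[1+ _ ] = + 0

coeffℤ-[] : ∀ j → coeffℤ [] j ≡ + 0
coeffℤ-[] (+ _)     = refl
coeffℤ-[] -[1+ _ ] = refl

coeffℤ-∷⊗ : ∀ a p q j → coeffℤ ((a ∷ p) ⊗ q) j ≡ a * coeffℤ q j + coeffℤ (p ⊗ q) (j - + 1)
coeffℤ-∷⊗ a p q (+ zero)  = trans (coeff-⊕ (scale a q) _ 0) (cong (_+ + 0) (coeff-scale a q 0))
coeffℤ-∷⊗ a p q (+ suc k)  = trans (coeff-⊕ (scale a q) _ (suc k)) (cong (_+ _) (coeff-scale a q (suc k)))
coeffℤ-∷⊗ a p q -[1+ _ ]  = sym (trans (+-identityʳ _) (*-zeroʳ a))

-- The coefficient of x^(j-1) in P·(Pⁿ)′ = n·P′·Pⁿ for P = a + b x + c x², where xᵢ stands for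
-- the coefficient of x^(j-i) in Pⁿ.
EulerRelation : (a b c n j x₀ x₁ x₂ : ℤ) → Set
EulerRelation a b c n j x₀ x₁ x₂ =
  a * j * x₀ + b * (j - + 1) * x₁ + c * (j - + 2) * x₂ ≡ n * (b * x₁ + + 2 * c * x₂)

EulerRelation-step : ∀ a b c n j {x₀ x₁ x₂ x₃ x₄ y₀ y₁ y₂} →
  y₀ ≡ a * x₀ + b * x₁ + c * x₂ → y₁ ≡ a * x₁ + b * x₂ + c * x₃ → y₂ ≡ a * x₂ + b * x₃ + c * x₄ →
  EulerRelation a b c n j x₀ x₁ x₂ → EulerRelation a b c n (j - + 1) x₁ x₂ x₃ →
  EulerRelation a b c n (j - + 1 - + 1) x₂ x₃ x₄ → EulerRelation a b c (+ 1 + n) j y₀ y₁ y₂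
EulerRelation-step a b c n j {x₀} {x₁} {x₂} {x₃} {x₄} refl refl refl =
  ≡-by-combination a b c (defect-step a b c n j x₀ x₁ x₂ x₃ x₄)
  where
  defect-step : ∀ a b c n j x₀ x₁ x₂ x₃ x₄ →
    let defect : ℤ → ℤ → ℤ → ℤ → ℤ → ℤ
        defect n j x₀ x₁ x₂ = a * j * x₀ + b * (j - + 1) * x₁ + c * (j - + 2) * x₂ - n * (b * x₁ + + 2 * c * x₂)
        y₀ = a * x₀ + b * x₁ + c * x₂
        y₁ = a * x₁ + b * x₂ + c * x₃
        y₂ = a * x₂ + b * x₃ + c * x₄
    in defect (+ 1 + n) j y₀ y₁ y₂ ≡
       a * defect n j x₀ x₁ x₂ + b * defect n (j - + 1) x₁ x₂ x₃ + c * defect n (j - + 1 - + 1) x₂ x₃ x₄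
  defect-step = solve-∀

module QuadraticPower (a b c : ℤ) where

  coeffPow : ℕ → ℤ → ℤ
  coeffPow n = coeffℤ ((a ∷ b ∷ c ∷ []) ^ᴾ n)

  coeffPow-suc : ∀ n j → coeffPow (suc n) j
                         ≡ a * coeffPow n j + b * coeffPow n (j - + 1) + c * coeffPow n (j - + 1 - + 1)
  coeffPow-suc n j = begin
    coeffPow (suc n) j                            ≡⟨ coeffℤ-∷⊗ a (b ∷ c ∷ []) q j ⟩
    a * x₀ + coeffℤ ((b ∷ c ∷ []) ⊗ q) j₁         ≡⟨ cong (_+_ (a * x₀)) (coeffℤ-∷⊗ b (c ∷ []) q j₁) ⟩
    a * x₀ + (b * x₁ + coeffℤ ((c ∷ []) ⊗ q) j₂)  ≡⟨ cong (λ t → a * x₀ + (b * x₁ + t)) (coeffℤ-∷⊗ c [] q j₂) ⟩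
    a * x₀ + (b * x₁ + (c * x₂ + coeffℤ [] j₃))   ≡⟨ cong (λ t → a * x₀ + (b * x₁ + (c * x₂ + t))) (coeffℤ-[] j₃) ⟩
    a * x₀ + (b * x₁ + (c * x₂ + + 0))            ≡⟨ reassociate (a * x₀) (b * x₁) (c * x₂) ⟩
    a * x₀ + b * x₁ + c * x₂                      ∎
    where
    open ≡-Reasoning
    q = (a ∷ b ∷ c ∷ []) ^ᴾ n
    j₁ = j - + 1
    j₂ = j₁ - + 1
    j₃ = j₂ - + 1
    x₀ = coeffPow n j
    x₁ = coeffPow n j₁
    x₂ = coeffPow n j₂
    reassociate : ∀ x y z → x + (y + (z + + 0)) ≡ x + y + z
    reassociate = solve-∀

  coeffPow-at-0 : ∀ n → coeffPow n (+ 0) ≡ a ^ n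
  coeffPow-at-0 zero    = refl
  coeffPow-at-0 (suc n) = begin
    coeffPow (suc n) (+ 0)                    ≡⟨ coeffPow-suc n (+ 0) ⟩
    a * coeffPow n (+ 0) + b * + 0 + c * + 0  ≡⟨ drop-zeros (a * coeffPow n (+ 0)) b c ⟩
    a * coeffPow n (+ 0)                      ≡⟨ cong (a *_) (coeffPow-at-0 n) ⟩
    a ^ suc n                                 ∎
    where
    open ≡-Reasoning
    drop-zeros : ∀ x b c → x + b * + 0 + c * + 0 ≡ x
    drop-zeros = solve-∀

  coeffPow-above-degree : ∀ n k → n ℕ.* 2 < k → coeffPow n (+ k) ≡ + 0
  coeffPow-above-degree zero    (suc k)       _                 = refl
  coeffPow-above-degree (suc n) (suc (suc k)) (s≤s (s≤s 2n<k)) = begin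
    coeffPow (suc n) (+ (2 ℕ.+ k))
      ≡⟨ coeffPow-suc n (+ (2 ℕ.+ k)) ⟩
    a * coeffPow n (+ (2 ℕ.+ k)) + b * coeffPow n (+ (1 ℕ.+ k)) + c * coeffPow n (+ k)
      ≡⟨ cong₂ _+_ (cong₂ _+_ (cong (a *_) (coeffPow-above-degree n _ (m<n⇒m<1+n (m<n⇒m<1+n 2n<k))))
                              (cong (b *_) (coeffPow-above-degree n _ (m<n⇒m<1+n 2n<k))))
                   (cong (c *_) (coeffPow-above-degree n k 2n<k)) ⟩
    a * + 0 + b * + 0 + c * + 0
      ≡⟨ zeros a b c ⟩
    + 0
      ∎
    where
    open ≡-Reasoning
    zeros : ∀ a b c → a * + 0 + b * + 0 + c * + 0 ≡ + 0
    zeros = solve-∀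

  weighted-coeffPow-zero : ∀ j → j * coeffPow 0 j ≡ + 0
  weighted-coeffPow-zero (+ zero)  = refl
  weighted-coeffPow-zero (+ suc k) = *-zeroʳ (+ suc k)
  weighted-coeffPow-zero -[1+ k ]  = *-zeroʳ -[1+ k ]

  euler : ∀ n j → EulerRelation a b c (+ n) j (coeffPow n j) (coeffPow n (j - + 1)) (coeffPow n (j - + 1 - + 1))
  euler zero j =
    ≡-by-combination a b c (base-defect a b c j x₀ x₁ x₂)
      (weighted-coeffPow-zero j) (weighted-coeffPow-zero (j - + 1)) (weighted-coeffPow-zero (j - + 1 - + 1))
    where
    x₀ = coeffPow 0 j
    x₁ = coeffPow 0 (j - + 1)
    x₂ = coeffPow 0 (j - + 1 - + 1)
    base-defect : ∀ a b c j x₀ x₁ x₂ →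
      a * j * x₀ + b * (j - + 1) * x₁ + c * (j - + 2) * x₂ - + 0 * (b * x₁ + + 2 * c * x₂)
      ≡ a * (j * x₀ - + 0) + b * ((j - + 1) * x₁ - + 0) + c * ((j - + 1 - + 1) * x₂ - + 0)
    base-defect = solve-∀
  euler (suc n) j =
    EulerRelation-step a b c (+ n) j
      (coeffPow-suc n j) (coeffPow-suc n (j - + 1)) (coeffPow-suc n (j - + 1 - + 1))
      (euler n j) (euler n (j - + 1)) (euler n (j - + 1 - + 1))

module CentralTrinomial where

  open QuadraticPower (+ 1) (+ 1) (+ 1)

  subcentral : ℕ → ℤ
  subcentral N = coeffPow N (+ N - + 1)

  -- At j = N + 1 the middle coefficient of the Euler relation vanishes, leaving (N + 1) (x₀ - x₂) = 0.
  coeffPow-symmetric-about-middle : ∀ N → coeffPow N (+ 1 + + N) ≡ subcentral N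
  coeffPow-symmetric-about-middle N =
    *-cancelˡ-≡ (+ 1 + + N) above below
      (≡-by-multiple (+ 1) (defect (+ N) above (T N) below) (euler N (+ 1 + + N)))
    where
    above = coeffPow N (+ 1 + + N)
    below = subcentral N
    defect : ∀ n x₀ x₁ x₂ →
      (+ 1 + n) * x₀ - (+ 1 + n) * x₂
      ≡ + 1 * (+ 1 * (+ 1 + n) * x₀ + + 1 * (+ 1 + n - + 1) * x₁ + + 1 * (+ 1 + n - + 2) * x₂
               - n * (+ 1 * x₁ + + 2 * + 1 * x₂))
    defect = solve-∀

  T-suc : ∀ N → T (suc N) ≡ T N + + 2 * subcentral N
  T-suc N = begin
    T (suc N)                                  ≡⟨ coeffPow-suc N (+ suc N) ⟩
    + 1 * above + + 1 * T N + + 1 * below      ≡⟨ cong (λ x → + 1 * x + + 1 * T N + + 1 * below)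
                                                       (coeffPow-symmetric-about-middle N) ⟩
    + 1 * below + + 1 * T N + + 1 * below      ≡⟨ collect (T N) below ⟩
    T N + + 2 * below                          ∎
    where
    open ≡-Reasoning
    above = coeffPow N (+ 1 + + N)
    below = subcentral N
    collect : ∀ t b → + 1 * b + + 1 * t + + 1 * b ≡ t + + 2 * b
    collect = solve-∀

  T-recurrence : ∀ N → (+ 2 + + N) * T (2 ℕ.+ N) ≡ (+ 3 + + 2 * + N) * T (1 ℕ.+ N) + + 3 * (+ 1 + + N) * T N
  T-recurrence N = eliminate (+ N) (T-suc N) (T-suc (suc N)) (coeffPow-suc N (+ N)) (euler N (+ N))
    where
    eliminate : ∀ n {t₀ t₁ t₂ b₀ b₁ c₀} →
      t₁ ≡ t₀ + + 2 * b₀ → t₂ ≡ t₁ + + 2 * b₁ → b₁ ≡ + 1 * t₀ + + 1 * b₀ + + 1 * c₀ →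
      + 1 * n * t₀ + + 1 * (n - + 1) * b₀ + + 1 * (n - + 2) * c₀ ≡ n * (+ 1 * b₀ + + 2 * + 1 * c₀) →
      (+ 2 + n) * t₂ ≡ (+ 3 + + 2 * n) * t₁ + + 3 * (+ 1 + n) * t₀
    eliminate n {t₀} {b₀ = b₀} {c₀ = c₀} refl refl refl = ≡-by-multiple (- + 2) (defect n t₀ b₀ c₀)
      where
      defect : ∀ n t₀ b₀ c₀ →
        let t₁ = t₀ + + 2 * b₀
            t₂ = t₁ + + 2 * (+ 1 * t₀ + + 1 * b₀ + + 1 * c₀)
        in (+ 2 + n) * t₂ - ((+ 3 + + 2 * n) * t₁ + + 3 * (+ 1 + n) * t₀)
           ≡ - + 2 * (+ 1 * n * t₀ + + 1 * (n - + 1) * b₀ + + 1 * (n - + 2) * c₀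
                      - n * (+ 1 * b₀ + + 2 * + 1 * c₀))
      defect = solve-∀

α β : ℕ → ℤ
α k = + 3 + + 2 * + k
β k = + 3 * (+ 1 + + k)

T-solves-recurrence : ∀ p → SolvesRecurrenceMod p α β T
T-solves-recurrence p k = ≡⇒≡-mod (CentralTrinomial.T-recurrence k)

module QuadrPower {p m : ℕ} (p≡1+m*2 : p ≡ 1 ℕ.+ m ℕ.* 2) where

  open QuadraticPower (+ 1) (- + 2) (- + 3)

  A : ℕ → ℤ
  A k = coeffPow m (+ k)

  +p≡1+m*2 : + p ≡ + 1 + + m * + 2
  +p≡1+m*2 = trans (cong +_ p≡1+m*2) (cong (_+_ (+ 1)) (pos-* m 2))

  A-solves-recurrence : SolvesRecurrenceMod p α β A
  A-solves-recurrence k = congruent (divides q (begin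
    + (2 ℕ.+ k) * A (2 ℕ.+ k) - (α k * A (1 ℕ.+ k) + β k * A k)
      ≡⟨ ≡-by-multiple (+ 1) (defect (+ k) (+ m) (A k) (A (1 ℕ.+ k)) (A (2 ℕ.+ k))) (euler m (+ (2 ℕ.+ k))) ⟩
    q * (+ 1 + + m * + 2)
      ≡⟨ cong (q *_) +p≡1+m*2 ⟨
    q * + p
      ∎))
    where
    open ≡-Reasoning
    q = - (A (1 ℕ.+ k) + + 3 * A k)
    defect : ∀ K M x₀ x₁ x₂ →
      (+ 2 + K) * x₂ - ((+ 3 + + 2 * K) * x₁ + + 3 * (+ 1 + K) * x₀) - (- (x₁ + + 3 * x₀)) * (+ 1 + M * + 2)
      ≡ + 1 * (+ 1 * (+ 2 + K) * x₂ + - + 2 * (+ 2 + K - + 1) * x₁ + - + 3 * (+ 2 + K - + 2) * x₀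
               - M * (- + 2 * x₁ + + 2 * - + 3 * x₀))
    defect = solve-∀

  A-zero : A 0 ≡ + 1
  A-zero = trans (coeffPow-at-0 m) (^-zeroˡ m)

  A-one : A 1 ≡ + 1 mod p
  A-one = congruent (divides (- + 1) (begin
    A 1 - + 1                  ≡⟨ from-euler (+ m) (A 1) A-zero (euler m (+ 1)) ⟩
    - + 1 * (+ 1 + + m * + 2)  ≡⟨ cong (- + 1 *_) +p≡1+m*2 ⟨
    - + 1 * + p                ∎))
    where
    open ≡-Reasoning
    from-euler : ∀ M x₁ {x₀} → x₀ ≡ + 1 →
      + 1 * + 1 * x₁ + - + 2 * (+ 1 - + 1) * x₀ + - + 3 * (+ 1 - + 2) * + 0 ≡ M * (- + 2 * x₀ + + 2 * - + 3 * + 0) →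
      x₁ - + 1 ≡ - + 1 * (+ 1 + M * + 2)
    from-euler M x₁ refl = ≡-by-multiple (+ 1) (defect M x₁)
      where
      defect : ∀ M x₁ →
        x₁ - + 1 - - + 1 * (+ 1 + M * + 2)
        ≡ + 1 * (+ 1 * + 1 * x₁ + - + 2 * (+ 1 - + 1) * + 1 + - + 3 * (+ 1 - + 2) * + 0
                 - M * (- + 2 * + 1 + + 2 * - + 3 * + 0))
      defect = solve-∀

  A-above-degree : ∀ {k} → p ≤ k → A k ≡ + 0
  A-above-degree {k} p≤k = coeffPow-above-degree m k (subst (_≤ k) p≡1+m*2 p≤k)

odd⇒≡1+[/2]*2 : ∀ {n} → ¬ 2 ∣ℕ n → n ≡ 1 ℕ.+ n / 2 ℕ.* 2
odd⇒≡1+[/2]*2 {n} 2∤n = trans (m≡m%n+[m/n]*n n 2) (cong (ℕ._+ n / 2 ℕ.* 2) n%2≡1)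
  where
  n%2≡1 : n % 2 ≡ 1
  n%2≡1 with n % 2 | m%n<n n 2 | m%n≡0⇒n∣m n 2
  ... | 0           | _              | 2∣n = contradiction (2∣n refl) 2∤n
  ... | 1           | _              | _   = refl
  ... | suc (suc _) | s≤s (s≤s ())  | _

proposition2 : (p : ℕ) → Prime p → ¬ (2 ∣ℕ p) →
    ∀ (k : ℕ) → (+ p) ∣ (truncT p k - coeff (quadr ^ᴾ (p / 2)) k)
proposition2 p p-prime p-odd k = ∣⇒∣ᵤ (_≡_mod_.divides-difference (truncT≡A k))
  where
  open QuadrPower {m = p / 2} (odd⇒≡1+[/2]*2 p-odd)
  truncT≡A : ∀ k → truncT p k ≡ A k mod p
  truncT≡A k with k <ᵇ p | <ᵇ-reflects-< k p
  ... | true  | ofʸ k<p = recurrence-solutions-≡-mod p-prime α β (T-solves-recurrence p) A-solves-recurrence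
                            (≡⇒≡-mod (sym A-zero)) (≡-mod-sym A-one) k<p
  ... | false | ofⁿ k≮p = ≡⇒≡-mod (sym (A-above-degree (≮⇒≥ k≮p)))
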